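{- Let $G,K,H$ be graphs with $H\leq_R K\leq_R G$, let $\Psi\in\hom_R(G,K)$, $\Delta\in\hom_R(K,H)$, and $\Phi=\Delta\circ\Psi$. Then: (1) The $\sim_\Psi$ classes in $V(G)$ are exactly the nonempty intersections of $\sim_\Phi$ classes with $\partial\Psi$-fibers. In particular, $\Psi$ is synchronizing if and only if every $\partial\Psi$-fiber is contained in a $\sim_\Phi$ class. (2) If $K=G/\sim_\Phi$ and $\Psi$ is the quotient map for $\sim_\Phi$ (and $\Delta$ the induced map $G/\sim_\Phi\to H$), then $\Psi$ is synchronizing and $\sim_\Delta$ is trivial. (3) If $\sim_\Delta$ is trivial, then $\sim_\Phi\,=\,\sim_\Psi$. (4) $\Phi$ is synchronizing if and only if both $\Psi$ and $\Delta$ are synchronizing.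
   Context: All graphs are finite directed graphs with state set $V(G)$, edge set $E(G)$, source/target maps $s,t$; loops and parallel edges allowed; all graphs sink-free. $E_I(G)=s^{ -1}(I)$, $L(G)$ finite edge paths, $L_I(G)$ those starting at $I$. A homomorphism $\Phi:G\to H$ consists of maps on edges and ($\partial\Phi$) on states commuting with $s,t$. A right-resolver is a surjective homomorphism with $\Phi|_{E_I(G)}:E_I(G)\to E_{\partial\Phi(I)}(H)$ bijective for all $I$; $\hom_R(G,H)$, $H\leq_R G$ if nonempty. For $\Phi\in\hom_R(G,H)$, $I\in V(G)$, $u\in L_{\partial\Phi(I)}(H)$, $I\cdot u$ is the endpoint of the unique $\gamma\in L_I(G)$ with $\Phi(\gamma)=u$. Stability relation: $I_1\sim_\Phi I_2$ iff $\partial\Phi(I_1)=\partial\Phi(I_2)=:I$ and for every $u\in L_I(H)$ there exists $v\in L_{t(u)}(H)$ with $I_1\cdot uv=I_2\cdot uv$; it is an equivalence relation, and it is a congruence: $I_1\sim_\Phi I_2$ implies $I_1\cdot u\sim_\Phi I_2\cdot u$. "Trivial" means equal to the equality relation. $\Phi$ is synchronizing if every fiber $(\partial\Phi)^{ -1}(I)$ is a single $\sim_\Phi$ class. Quotient: $G/\sim_\Phi$ has states $V(G)/\sim_\Phi$ and edges the classes of edges under $e_1\sim e_2$ iff $\Phi(e_1)=\Phi(e_2)$ and $s(e_1)\sim_\Phi s(e_2)$, with source/target the classes of source/target; the quotient map $G\to G/\sim_\Phi$ and the map $G/\sim_\Phi\to H$ sending a class to the $\Phi$-image of a representative are right-resolvers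 composing to $\Phi$. -}

module Defs where

open import Data.Nat using (ℕ)
open import Data.Fin using (Fin)
open import Data.List using (List; []; _∷_; _++_; map)
open import Data.Product using (Σ; ∃; _×_; _,_)
open import Data.Unit using (⊤)
open import Relation.Binary.PropositionalEquality using (_≡_)
open import Function.Bundles using (_⇔_)

record Graph : Set where
  field
    nV : ℕ
    nE : ℕ
    s  : Fin nE → Fin nV
    t  : Fin nE → Fin nV
    sinkFree : ∀ (I : Fin nV) → ∃ λ (e : Fin nE) → s e ≡ I

open Graph public

V : Graph → Set
V G = Fin (nV G)

E : Graph → Set
E G = Fin (nE G)

-- Finite edge paths: a list of edges together with the requirement that
-- it is a path starting at the state I.  L_I(G) = { γ | Valid G I γ }.
-- The empty list is the empty path at I.

Valid : (G : Graph) → V G → List (E G) → Set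
Valid G I []      = ⊤
Valid G I (e ∷ γ) = (s G e ≡ I) × Valid G (t G e) γ

endpt : (G : Graph) → V G → List (E G) → V G
endpt G I []      = I
endpt G I (e ∷ γ) = endpt G (t G e) γ

record Hom (G H : Graph) : Set where
  field
    mapE : E G → E H
    ∂    : V G → V H
    comm-s : ∀ e → s H (mapE e) ≡ ∂ (s G e)
    comm-t : ∀ e → t H (mapE e) ≡ ∂ (t G e)

open Hom public

_∘H_ : ∀ {G K H} → Hom K H → Hom G K → Hom G H
_∘H_ {G} {K} {H} Δ Ψ = record
  { mapE = λ e → mapE Δ (mapE Ψ e)
  ; ∂ = λ I → ∂ Δ (∂ Ψ I)
  ; comm-s = λ e → trans' (comm-s Δ (mapE Ψ e)) (cong' (∂ Δ) (comm-s Ψ e))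
  ; comm-t = λ e → trans' (comm-t Δ (mapE Ψ e)) (cong' (∂ Δ) (comm-t Ψ e))
  }
  where
    open import Relation.Binary.PropositionalEquality
      renaming (trans to trans'; cong to cong')

record IsRightResolver {G H : Graph} (Φ : Hom G H) : Set where
  field
    surjV : ∀ (J : V H) → ∃ λ (I : V G) → ∂ Φ I ≡ J
    surjE : ∀ (f : E H) → ∃ λ (e : E G) → mapE Φ e ≡ f
    outInj : ∀ (I : V G) (e₁ e₂ : E G) → s G e₁ ≡ I → s G e₂ ≡ I →
             mapE Φ e₁ ≡ mapE Φ e₂ → e₁ ≡ e₂
    outSurj : ∀ (I : V G) (f : E H) → s H f ≡ ∂ Φ I →
              ∃ λ (e : E G) → (s G e ≡ I) × (mapE Φ e ≡ f)

-- I · w = J : the endpoint of the (for a right-resolver, unique) path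
-- γ ∈ L_I(G) with Φ(γ) = w is J.

_·⟨_⟩_≡_ : ∀ {G H} → V G → Hom G H → List (E H) → V G → Set
_·⟨_⟩_≡_ {G} I Φ w J =
  Σ (List (E G)) λ γ → Valid G I γ × (map (mapE Φ) γ ≡ w) × (endpt G I γ ≡ J)

Stable : ∀ {G H} → Hom G H → V G → V G → Set
Stable {G} {H} Φ I₁ I₂ =
  (∂ Φ I₁ ≡ ∂ Φ I₂) ×
  (∀ (u : List (E H)) → Valid H (∂ Φ I₁) u →
     Σ (List (E H)) λ v → Valid H (endpt H (∂ Φ I₁) u) v ×
       Σ (V G) λ J → (I₁ ·⟨ Φ ⟩ (u ++ v) ≡ J) × (I₂ ·⟨ Φ ⟩ (u ++ v) ≡ J))

StabTrivial : ∀ {G H} → Hom G H → Set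
StabTrivial {G} Φ = ∀ (I₁ I₂ : V G) → Stable Φ I₁ I₂ → I₁ ≡ I₂

Synchronizing : ∀ {G H} → Hom G H → Set
Synchronizing {G} Φ = ∀ (I₁ I₂ : V G) → ∂ Φ I₁ ≡ ∂ Φ I₂ → Stable Φ I₁ I₂

-- Ψ : G → K is (up to isomorphism of K) the quotient map G → G/∼_Φ:
-- it identifies two states iff they are ∼_Φ-related, and two edges iff
-- they have the same Φ-image and ∼_Φ-related sources (surjectivity of Ψ
-- is part of Ψ being a right-resolver).
IsQuotientMapFor : ∀ {G K H} → Hom G K → Hom G H → Set
IsQuotientMapFor {G} Ψ Φ =
  (∀ (I₁ I₂ : V G) → (∂ Ψ I₁ ≡ ∂ Ψ I₂) ⇔ Stable Φ I₁ I₂) ×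
  (∀ (e₁ e₂ : E G) → (mapE Ψ e₁ ≡ mapE Ψ e₂) ⇔
      ((mapE Φ e₁ ≡ mapE Φ e₂) × Stable Φ (s G e₁) (s G e₂)))

-- Everything reduces to how the three relations see words.  A word of H is
-- read from a state of G through Φ = Δ ∘ Ψ exactly as its unique Δ-lift is
-- read through Ψ, and the Ψ-reading of a word lies over its Δ-reading from
-- the ∂Ψ-image.  Hence ∼Ψ ⊆ ∼Φ, ∼Φ restricted to a ∂Ψ-fibre is ∼Ψ, and ∼Φ
-- projects into ∼Δ.  Conversely, if every ∂Ψ-fibre lies in a ∼Φ class, then
-- ∼Δ-related images pull back to ∼Φ-related states: after a word
-- synchronizing the images, the two readings in G land in one ∂Ψ-fibre,
-- and one more word synchronizes them.
module Submission where

open import Defs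
open import Data.Product using (Σ; _×_; _,_; proj₁; proj₂)
open import Data.List using (List; []; _∷_; _++_; map)
open import Data.List.Properties using (map-++; map-∘; ++-assoc; ∷-injective)
open import Data.Unit using (tt)
open import Relation.Binary.PropositionalEquality
  using (_≡_; refl; sym; trans; cong; cong₂; subst; subst₂)
open import Function.Bundles using (_⇔_; mk⇔; Equivalence)

module _ (G : Graph) where

  Valid-++ : ∀ I γ δ → Valid G I γ → Valid G (endpt G I γ) δ → Valid G I (γ ++ δ)
  Valid-++ I []      δ _          vδ = vδ
  Valid-++ I (e ∷ γ) δ (se , vγ) vδ = se , Valid-++ (t G e) γ δ vγ vδ

  Valid-++⁻ʳ : ∀ I γ δ → Valid G I (γ ++ δ) → Valid G (endpt G I γ) δ
  Valid-++⁻ʳ I []      δ vδ       = vδ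
  Valid-++⁻ʳ I (e ∷ γ) δ (_ , vγδ) = Valid-++⁻ʳ (t G e) γ δ vγδ

  endpt-++ : ∀ I γ δ → endpt G I (γ ++ δ) ≡ endpt G (endpt G I γ) δ
  endpt-++ I []      δ = refl
  endpt-++ I (e ∷ γ) δ = endpt-++ (t G e) γ δ

module _ {G H : Graph} (Φ : Hom G H) where

  map-Valid : ∀ I γ → Valid G I γ → Valid H (∂ Φ I) (map (mapE Φ) γ)
  map-Valid I []      _         = tt
  map-Valid I (e ∷ γ) (se , vγ) =
    trans (comm-s Φ e) (cong (∂ Φ) se) ,
    subst (λ X → Valid H X (map (mapE Φ) γ)) (sym (comm-t Φ e)) (map-Valid (t G e) γ vγ)

  endpt-map : ∀ I γ → endpt H (∂ Φ I) (map (mapE Φ) γ) ≡ ∂ Φ (endpt G I γ)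
  endpt-map I []      = refl
  endpt-map I (e ∷ γ) =
    trans (cong (λ X → endpt H X (map (mapE Φ) γ)) (comm-t Φ e)) (endpt-map (t G e) γ)

  ·-Valid : ∀ {I J w} → I ·⟨ Φ ⟩ w ≡ J → Valid H (∂ Φ I) w
  ·-Valid {I} (γ , vγ , refl , _) = map-Valid I γ vγ

  ·-endpt : ∀ {I J w} → I ·⟨ Φ ⟩ w ≡ J → endpt H (∂ Φ I) w ≡ ∂ Φ J
  ·-endpt {I} (γ , _ , refl , refl) = endpt-map I γ

  ·-++ : ∀ {I J L u v} → I ·⟨ Φ ⟩ u ≡ J → J ·⟨ Φ ⟩ v ≡ L → I ·⟨ Φ ⟩ (u ++ v) ≡ L
  ·-++ {I} (γ , vγ , refl , refl) (δ , vδ , refl , refl) =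
    γ ++ δ , Valid-++ G I γ δ vγ vδ , map-++ (mapE Φ) γ δ , endpt-++ G I γ δ

  Meet : V G → V G → List (E H) → Set
  Meet I₁ I₂ w = Σ (V G) λ J → (I₁ ·⟨ Φ ⟩ w ≡ J) × (I₂ ·⟨ Φ ⟩ w ≡ J)

  Meet-sym : ∀ {I₁ I₂ w} → Meet I₁ I₂ w → Meet I₂ I₁ w
  Meet-sym (J , r₁ , r₂) = J , r₂ , r₁

  -- The validity of the synchronizing continuation is implied by the meeting.
  stable : ∀ {I₁ I₂} → ∂ Φ I₁ ≡ ∂ Φ I₂ →
           (∀ u → Valid H (∂ Φ I₁) u → Σ (List (E H)) λ v → Meet I₁ I₂ (u ++ v)) →
           Stable Φ I₁ I₂
  stable {I₁} ∂≡ sync = ∂≡ , λ u vu →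
    let (v , m@(_ , r₁ , _)) = sync u vu
    in v , Valid-++⁻ʳ H (∂ Φ I₁) u v (·-Valid r₁) , m

  Stable-sym : ∀ {I₁ I₂} → Stable Φ I₁ I₂ → Stable Φ I₂ I₁
  Stable-sym (∂≡ , sync) = stable (sym ∂≡) λ u vu →
    let (v , _ , m) = sync u (subst (λ X → Valid H X u) (sym ∂≡) vu)
    in v , Meet-sym m

module _ {G H : Graph} {Φ : Hom G H} (R : IsRightResolver Φ) where
  open IsRightResolver R

  lift : ∀ I w → Valid H (∂ Φ I) w → Σ (List (E G)) λ γ → Valid G I γ × (map (mapE Φ) γ ≡ w)
  lift I []      _        = [] , tt , refl
  lift I (f ∷ w) (sf , vw) =
    let (e , se , e↦f) = outSurj I f sf
        (γ , vγ , γ↦w) = lift (t G e) w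
          (subst (λ X → Valid H X w) (trans (cong (t H) (sym e↦f)) (comm-t Φ e)) vw)
    in e ∷ γ , (se , vγ) , cong₂ _∷_ e↦f γ↦w

  lift-unique : ∀ I γ₁ γ₂ → Valid G I γ₁ → Valid G I γ₂ →
                map (mapE Φ) γ₁ ≡ map (mapE Φ) γ₂ → γ₁ ≡ γ₂
  lift-unique I []        []        _          _          _  = refl
  lift-unique I (e₁ ∷ γ₁) (e₂ ∷ γ₂) (se₁ , v₁) (se₂ , v₂) eq with ∷-injective eq
  ... | e₁≈e₂ , γ₁≈γ₂ with outInj I e₁ e₂ se₁ se₂ e₁≈e₂
  ... | refl = cong (e₁ ∷_) (lift-unique (t G e₁) γ₁ γ₂ v₁ v₂ γ₁≈γ₂)

  ·-total : ∀ {I w} → Valid H (∂ Φ I) w → Σ (V G) λ J → I ·⟨ Φ ⟩ w ≡ J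
  ·-total {I} {w} vw = let (γ , vγ , γ↦w) = lift I w vw in endpt G I γ , γ , vγ , γ↦w , refl

  ·-functional : ∀ {I w J₁ J₂} → I ·⟨ Φ ⟩ w ≡ J₁ → I ·⟨ Φ ⟩ w ≡ J₂ → J₁ ≡ J₂
  ·-functional {I} (γ₁ , v₁ , refl , refl) (γ₂ , v₂ , γ₂↦w , refl) =
    cong (endpt G I) (lift-unique I γ₁ γ₂ v₁ v₂ (sym γ₂↦w))

  ·-++⁻ʳ : ∀ {I J L u v} → I ·⟨ Φ ⟩ u ≡ J → I ·⟨ Φ ⟩ (u ++ v) ≡ L → J ·⟨ Φ ⟩ v ≡ L
  ·-++⁻ʳ {I} {u = u} {v} ru ruv =
    let vv = subst (λ X → Valid H X v) (·-endpt Φ ru)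
               (Valid-++⁻ʳ H (∂ Φ I) u v (·-Valid Φ ruv))
        (_ , rv) = ·-total vv
    in subst (λ X → _ ·⟨ Φ ⟩ v ≡ X) (·-functional (·-++ Φ ru rv) ruv) rv

  Stable-trans : ∀ {I₁ I₂ I₃} → Stable Φ I₁ I₂ → Stable Φ I₂ I₃ → Stable Φ I₁ I₃
  Stable-trans {I₁} {I₃ = I₃} (∂≡₁₂ , sync₁₂) (∂≡₂₃ , sync₂₃) =
    stable Φ (trans ∂≡₁₂ ∂≡₂₃) λ u vu →
      let (v₁ , _ , J , r₁ , r₂) = sync₁₂ u vu
          (v₂ , _ , J′ , r₂′ , r₃′) = sync₂₃ (u ++ v₁) (·-Valid Φ r₂)
          r₁′ = ·-++ Φ r₁ (·-++⁻ʳ r₂ r₂′)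
      in v₁ ++ v₂ , subst (Meet Φ I₁ I₃) (++-assoc u v₁ v₂) (J′ , r₁′ , r₃′)

∘-IsRightResolver : ∀ {G K H} {Ψ : Hom G K} {Δ : Hom K H} →
                    IsRightResolver Ψ → IsRightResolver Δ → IsRightResolver (Δ ∘H Ψ)
∘-IsRightResolver {Ψ = Ψ} {Δ} RΨ RΔ = record
  { surjV = λ J → let (k , k↦J) = RΔ.surjV J ; (I , I↦k) = RΨ.surjV k
                  in I , trans (cong (∂ Δ) I↦k) k↦J
  ; surjE = λ f → let (f′ , f′↦f) = RΔ.surjE f ; (e , e↦f′) = RΨ.surjE f′
                  in e , trans (cong (mapE Δ) e↦f′) f′↦f
  ; outInj = λ I e₁ e₂ se₁ se₂ eq →
      RΨ.outInj I e₁ e₂ se₁ se₂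
        (RΔ.outInj (∂ Ψ I) (mapE Ψ e₁) (mapE Ψ e₂)
          (trans (comm-s Ψ e₁) (cong (∂ Ψ) se₁)) (trans (comm-s Ψ e₂) (cong (∂ Ψ) se₂)) eq)
  ; outSurj = λ I f sf →
      let (f′ , sf′ , f′↦f) = RΔ.outSurj (∂ Ψ I) f sf
          (e , se , e↦f′) = RΨ.outSurj I f′ sf′
      in e , se , trans (cong (mapE Δ) e↦f′) f′↦f
  }
  where
  module RΨ = IsRightResolver RΨ
  module RΔ = IsRightResolver RΔ

module _ {G K H : Graph} (Ψ : Hom G K) (Δ : Hom K H) where

  private
    Φ : Hom G H
    Φ = Δ ∘H Ψ

  ·-∘⁺ : ∀ {I J w} → I ·⟨ Ψ ⟩ w ≡ J → I ·⟨ Φ ⟩ map (mapE Δ) w ≡ J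
  ·-∘⁺ (γ , vγ , refl , e) = γ , vγ , map-∘ γ , e

  ·-∘-image : ∀ {I J u} → I ·⟨ Φ ⟩ u ≡ J → ∂ Ψ I ·⟨ Δ ⟩ u ≡ ∂ Ψ J
  ·-∘-image {I} (γ , vγ , refl , refl) =
    map (mapE Ψ) γ , map-Valid Ψ I γ vγ , sym (map-∘ γ) , endpt-map Ψ I γ

  ·-∘-lift : IsRightResolver Ψ → ∀ {I k u} → ∂ Ψ I ·⟨ Δ ⟩ u ≡ k →
             Σ (V G) λ L → (I ·⟨ Φ ⟩ u ≡ L) × (∂ Ψ L ≡ k)
  ·-∘-lift RΨ {I} (δ , vδ , refl , refl) =
    let (L , r) = ·-total RΨ {I} {δ} vδ
    in L , ·-∘⁺ r , sym (·-endpt Ψ r)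

  module _ (RΔ : IsRightResolver Δ) where

    ·-∘⁻ : ∀ {I J w} → Valid K (∂ Ψ I) w → I ·⟨ Φ ⟩ map (mapE Δ) w ≡ J → I ·⟨ Ψ ⟩ w ≡ J
    ·-∘⁻ {I} {w = w} vw (γ , vγ , γ↦w , e) =
      γ , vγ ,
      lift-unique RΔ (∂ Ψ I) (map (mapE Ψ) γ) w (map-Valid Ψ I γ vγ) vw
        (trans (sym (map-∘ γ)) γ↦w) ,
      e

    Stable-Ψ⇒Stable-∘ : ∀ {I₁ I₂} → Stable Ψ I₁ I₂ → Stable Φ I₁ I₂
    Stable-Ψ⇒Stable-∘ {I₁} {I₂} (∂≡ , sync) = stable Φ (cong (∂ Δ) ∂≡) λ u vu →
      let (u′ , vu′ , u′↦u) = lift RΔ (∂ Ψ I₁) u vu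
          (v′ , _ , J , r₁ , r₂) = sync u′ vu′
          u′v′↦ = trans (map-++ (mapE Δ) u′ v′) (cong (_++ map (mapE Δ) v′) u′↦u)
      in map (mapE Δ) v′ , subst (Meet Φ I₁ I₂) u′v′↦ (J , ·-∘⁺ r₁ , ·-∘⁺ r₂)

    Stable-∘⇒Stable-Ψ : ∀ {I₁ I₂} → Stable Φ I₁ I₂ → ∂ Ψ I₁ ≡ ∂ Ψ I₂ → Stable Ψ I₁ I₂
    Stable-∘⇒Stable-Ψ {I₁} {I₂} (_ , sync) ∂≡ = stable Ψ ∂≡ λ u′ vu′ →
      let (v , vv , J , r₁ , r₂) = sync (map (mapE Δ) u′) (map-Valid Δ (∂ Ψ I₁) u′ vu′)
          (v′ , vv′ , v′↦v) = lift RΔ (endpt K (∂ Ψ I₁) u′) v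
            (subst (λ X → Valid H X v) (endpt-map Δ (∂ Ψ I₁) u′) vv)
          vw₁ = Valid-++ K (∂ Ψ I₁) u′ v′ vu′ vv′
          vw₂ = subst (λ X → Valid K X (u′ ++ v′)) ∂≡ vw₁
          w↦ = trans (map-++ (mapE Δ) u′ v′) (cong (map (mapE Δ) u′ ++_) v′↦v)
          (J′ , r₁′ , r₂′) = subst (Meet Φ I₁ I₂) (sym w↦) (J , r₁ , r₂)
      in v′ , J′ , ·-∘⁻ vw₁ r₁′ , ·-∘⁻ vw₂ r₂′

  Stable-∘⇒Stable-Δ : ∀ {I₁ I₂} → Stable Φ I₁ I₂ → Stable Δ (∂ Ψ I₁) (∂ Ψ I₂)
  Stable-∘⇒Stable-Δ (∂≡ , sync) = ∂≡ , λ u vu →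
    let (v , vv , J , r₁ , r₂) = sync u vu
    in v , vv , ∂ Ψ J , ·-∘-image r₁ , ·-∘-image r₂

  FibresStable : Set
  FibresStable = ∀ I₁ I₂ → ∂ Ψ I₁ ≡ ∂ Ψ I₂ → Stable Φ I₁ I₂

  Stable-Δ⇒Stable-∘ : IsRightResolver Ψ → FibresStable →
                      ∀ {I₁ I₂} → Stable Δ (∂ Ψ I₁) (∂ Ψ I₂) → Stable Φ I₁ I₂
  Stable-Δ⇒Stable-∘ RΨ fibres {I₁} {I₂} (∂≡ , sync) = stable Φ ∂≡ λ u vu →
    let (v , _ , _ , s₁ , s₂) = sync u vu
        (L₁ , r₁ , L₁↦k) = ·-∘-lift RΨ s₁
        (L₂ , r₂ , L₂↦k) = ·-∘-lift RΨ s₂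
        (w , _ , J , q₁ , q₂) = proj₂ (fibres L₁ L₂ (trans L₁↦k (sym L₂↦k))) [] tt
    in v ++ w , subst (Meet Φ I₁ I₂) (++-assoc u v w) (J , ·-++ Φ r₁ q₁ , ·-++ Φ r₂ q₂)

module _ {G K H : Graph} {Ψ : Hom G K} {Δ : Hom K H}
         (RΨ : IsRightResolver Ψ) (RΔ : IsRightResolver Δ) where

  private
    Φ : Hom G H
    Φ = Δ ∘H Ψ

    RΦ : IsRightResolver Φ
    RΦ = ∘-IsRightResolver RΨ RΔ

    preimage : ∀ k → Σ (V G) λ I → ∂ Ψ I ≡ k
    preimage = IsRightResolver.surjV RΨ

  Stable-Ψ⇔Stable-∘×fibre : ∀ I J → Stable Ψ I J ⇔ (Stable Φ I J × (∂ Ψ J ≡ ∂ Ψ I))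
  Stable-Ψ⇔Stable-∘×fibre I J = mk⇔
    (λ st → Stable-Ψ⇒Stable-∘ Ψ Δ RΔ st , sym (proj₁ st))
    (λ (st , ∂≡) → Stable-∘⇒Stable-Ψ Ψ Δ RΔ st (sym ∂≡))

  Stable-∘-class∩fibre⇔Stable-Ψ : ∀ A k J₀ → Stable Φ A J₀ → ∂ Ψ J₀ ≡ k →
                         ∀ J → (Stable Φ A J × (∂ Ψ J ≡ k)) ⇔ Stable Ψ J₀ J
  Stable-∘-class∩fibre⇔Stable-Ψ A k J₀ A∼J₀ J₀↦k J = mk⇔
    (λ (A∼J , J↦k) → Equivalence.from (Stable-Ψ⇔Stable-∘×fibre J₀ J)
       (Stable-trans RΦ (Stable-sym Φ A∼J₀) A∼J , trans J↦k (sym J₀↦k)))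
    (λ J₀∼J → let (J₀∼ΦJ , ∂≡) = Equivalence.to (Stable-Ψ⇔Stable-∘×fibre J₀ J) J₀∼J
              in Stable-trans RΦ A∼J₀ J₀∼ΦJ , trans ∂≡ J₀↦k)

  Synchronizing⇔fibres⊆Stable-∘-class :
    Synchronizing Ψ ⇔ (∀ k → Σ (V G) λ A → ∀ J → ∂ Ψ J ≡ k → Stable Φ A J)
  Synchronizing⇔fibres⊆Stable-∘-class = mk⇔
    (λ sync k → let (A , A↦k) = preimage k
                in A , λ J J↦k → Stable-Ψ⇒Stable-∘ Ψ Δ RΔ (sync A J (trans A↦k (sym J↦k))))
    (λ classes I₁ I₂ ∂≡ → let (A , A∼) = classes (∂ Ψ I₁)
      in Stable-∘⇒Stable-Ψ Ψ Δ RΔ (Stable-trans RΦ (Stable-sym Φ (A∼ I₁ refl)) (A∼ I₂ (sym ∂≡))) ∂≡)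

  quotient⇒Synchronizing×StabTrivial : IsQuotientMapFor Ψ Φ → Synchronizing Ψ × StabTrivial Δ
  quotient⇒Synchronizing×StabTrivial (states , _) = sync , trivial
    where
    sync : Synchronizing Ψ
    sync I₁ I₂ ∂≡ = Stable-∘⇒Stable-Ψ Ψ Δ RΔ (Equivalence.to (states I₁ I₂) ∂≡) ∂≡

    trivial : StabTrivial Δ
    trivial k₁ k₂ k₁∼k₂ =
      let (I₁ , I₁↦k₁) = preimage k₁
          (I₂ , I₂↦k₂) = preimage k₂
          I₁∼I₂ = Stable-Δ⇒Stable-∘ Ψ Δ RΨ (λ L₁ L₂ → Equivalence.to (states L₁ L₂))
                    (subst₂ (Stable Δ) (sym I₁↦k₁) (sym I₂↦k₂) k₁∼k₂)
      in trans (sym I₁↦k₁) (trans (Equivalence.from (states I₁ I₂) I₁∼I₂) I₂↦k₂)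

  StabTrivial⇒Stable-∘⇔Stable-Ψ : StabTrivial Δ → ∀ I₁ I₂ → Stable Φ I₁ I₂ ⇔ Stable Ψ I₁ I₂
  StabTrivial⇒Stable-∘⇔Stable-Ψ trivial I₁ I₂ = mk⇔
    (λ st → Stable-∘⇒Stable-Ψ Ψ Δ RΔ st (trivial _ _ (Stable-∘⇒Stable-Δ Ψ Δ st)))
    (Stable-Ψ⇒Stable-∘ Ψ Δ RΔ)

  Synchronizing-∘⇔ : Synchronizing Φ ⇔ (Synchronizing Ψ × Synchronizing Δ)
  Synchronizing-∘⇔ = mk⇔
    (λ sync → (λ I₁ I₂ ∂≡ → Stable-∘⇒Stable-Ψ Ψ Δ RΔ (sync I₁ I₂ (cong (∂ Δ) ∂≡)) ∂≡) ,
              (λ k₁ k₂ ∂≡ →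
                 let (I₁ , I₁↦k₁) = preimage k₁
                     (I₂ , I₂↦k₂) = preimage k₂
                     ∂I₁≡∂I₂ = trans (cong (∂ Δ) I₁↦k₁) (trans ∂≡ (sym (cong (∂ Δ) I₂↦k₂)))
                 in subst₂ (Stable Δ) I₁↦k₁ I₂↦k₂
                      (Stable-∘⇒Stable-Δ Ψ Δ (sync I₁ I₂ ∂I₁≡∂I₂))))
    (λ (syncΨ , syncΔ) I₁ I₂ ∂≡ →
       Stable-Δ⇒Stable-∘ Ψ Δ RΨ (λ L₁ L₂ ∂≡′ → Stable-Ψ⇒Stable-∘ Ψ Δ RΔ (syncΨ L₁ L₂ ∂≡′))
         (syncΔ _ _ ∂≡))

theorem3p9 : ∀ (G K H : Graph) (Ψ : Hom G K) (Δ : Hom K H) →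
    IsRightResolver Ψ → IsRightResolver Δ →
    ((∀ (I : V G) → Σ (V G) λ A → Σ (V K) λ k →
        ∀ (J : V G) → Stable Ψ I J ⇔ (Stable (Δ ∘H Ψ) A J × (∂ Ψ J ≡ k)))
    × (∀ (A : V G) (k : V K) (J₀ : V G) → Stable (Δ ∘H Ψ) A J₀ → ∂ Ψ J₀ ≡ k →
        ∀ (J : V G) → (Stable (Δ ∘H Ψ) A J × (∂ Ψ J ≡ k)) ⇔ Stable Ψ J₀ J)
    × (Synchronizing Ψ ⇔
        (∀ (k : V K) → Σ (V G) λ A → ∀ (J : V G) → ∂ Ψ J ≡ k → Stable (Δ ∘H Ψ) A J)))
    × (IsQuotientMapFor Ψ (Δ ∘H Ψ) → Synchronizing Ψ × StabTrivial Δ)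
    × (StabTrivial Δ → ∀ (I₁ I₂ : V G) → Stable (Δ ∘H Ψ) I₁ I₂ ⇔ Stable Ψ I₁ I₂)
    × (Synchronizing (Δ ∘H Ψ) ⇔ (Synchronizing Ψ × Synchronizing Δ))
theorem3p9 G K H Ψ Δ RΨ RΔ =
  ( (λ I → I , ∂ Ψ I , Stable-Ψ⇔Stable-∘×fibre RΨ RΔ I)
  , Stable-∘-class∩fibre⇔Stable-Ψ RΨ RΔ
  , Synchronizing⇔fibres⊆Stable-∘-class RΨ RΔ )
  , quotient⇒Synchronizing×StabTrivial RΨ RΔ
  , StabTrivial⇒Stable-∘⇔Stable-Ψ RΨ RΔ
  , Synchronizing-∘⇔ RΨ RΔ
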